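{- Let $\Gamma=(V,E)$ be a finite connected distance-regular graph with $N=|V|$ vertices, diameter $d\ge 2$, valency $\kappa$, intersection array $\{b_0,\dots,b_{d-1};c_1,\dots,c_d\}$ and valencies $\kappa_0,\kappa_1,\dots,\kappa_d$. Regard $\Gamma$ as a resistor network in which every edge is a resistor of resistance $1$, and let $R(\alpha,\beta)$ denote the effective resistance (resistance distance) between vertices $\alpha,\beta$. Then for every $m\in\{1,2,\dots,d-1\}$ and all vertices $\alpha,\beta,\gamma\in V$ with $\partial(\alpha,\beta)=m$ and $\partial(\alpha,\gamma)=m+1$, $$R(\alpha,\gamma)-R(\alpha,\beta)=\frac{2}{N\kappa_m b_m}\Big(N-\sum_{l=0}^{m}\kappa_l\Big)>0 .$$ In particular, the effective resistance between $\alpha$ and a vertex at distance $m+1$ is strictly larger than that between $\alpha$ and a vertex at distance $m$.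
   Context: $\partial(\alpha,\beta)$ denotes the shortest-path distance in $\Gamma$. A connected graph of diameter $d$ is distance-regular if for all vertices $\alpha,\beta$ with $\partial(\alpha,\beta)=i$ the numbers $c_i=|\{\gamma:\partial(\alpha,\gamma)=i-1,\ \partial(\gamma,\beta)=1\}|$, $a_i=|\{\gamma:\partial(\alpha,\gamma)=i,\ \partial(\gamma,\beta)=1\}|$ and $b_i=|\{\gamma:\partial(\alpha,\gamma)=i+1,\ \partial(\gamma,\beta)=1\}|$ depend only on $i$; then $\Gamma$ is $\kappa$-regular with $\kappa=b_0$, and $a_i+b_i+c_i=\kappa$, $c_0=b_d=0$, $c_1=1$. The valency $\kappa_i$ is the number of vertices at distance $i$ from any fixed vertex; $\kappa_0=1$, $\kappa_1=\kappa$ and $\kappa_{i-1}b_{i-1}=\kappa_i c_i$. The effective resistance is $R(\alpha,\beta)=L^{+}_{\alpha\alpha}+L^{+}_{\beta\beta}-L^{+}_{\alpha\beta}-L^{+}_{\beta\alpha}$, where $L=\kappa I-A$ is the Laplacian of $\Gamma$ ($A$ the adjacency matrix) and $L^{+}$ is its Moore–Penrose pseudo-inverse, i.e. $L^{+}=\sum_{\lambda\neq 0}\lambda^{ -1}E_\lambda$ with $E_\lambda$ the orthogonal projection onto the $\lambda$-eigenspace of $L$. -}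

module Defs where

open import Data.Nat using (ℕ; zero; suc; _≤_)
open import Data.Integer using (+_)
open import Data.Bool using (Bool; true; false; _∧_; _∨_; not; if_then_else_)
open import Data.Fin using (Fin; zero; suc)
import Data.Fin as Fin
open import Data.Product using (Σ; ∃; _×_)
open import Relation.Nullary using (yes; no)
open import Relation.Nullary.Decidable using (⌊_⌋)
open import Relation.Binary.PropositionalEquality using (_≡_)
open import Data.Rational using (ℚ; _/_; 0ℚ; _+_; _-_; _*_; -_; _÷_; 1ℚ; ≢-nonZero)
open import Data.Rational.Properties using (_≟_)

ℕtoℚ : ℕ → ℚ
ℕtoℚ n = + n / 1

-- total division on ℚ (p /ᵗ 0 = 0); only used with nonzero denominators
_/ᵗ_ : ℚ → ℚ → ℚ
p /ᵗ q with q ≟ 0ℚ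
... | yes _ = 0ℚ
... | no q≢0 = _÷_ p q {{≢-nonZero q≢0}}

sumQ : ∀ {n} → (Fin n → ℚ) → ℚ
sumQ {zero}  f = 0ℚ
sumQ {suc n} f = f zero + sumQ (λ i → f (suc i))

countFin : ∀ {n} → (Fin n → Bool) → ℕ
countFin {zero}  P = 0
countFin {suc n} P = (if P zero then 1 else 0) Data.Nat.+ countFin (λ i → P (suc i))

anyFin : ∀ {n} → (Fin n → Bool) → Bool
anyFin {zero}  P = false
anyFin {suc n} P = P zero ∨ anyFin (λ i → P (suc i))

sumUpTo : ℕ → (ℕ → ℕ) → ℕ
sumUpTo zero    f = f 0
sumUpTo (suc m) f = sumUpTo m f Data.Nat.+ f (suc m)

record SimpleGraph (N : ℕ) : Set where
  field
    adj        : Fin N → Fin N → Bool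
    adj-sym    : ∀ x y → adj x y ≡ adj y x
    adj-irrefl : ∀ x → adj x x ≡ false
open SimpleGraph public

module _ {N : ℕ} (G : SimpleGraph N) where

  -- reach k α β = true  iff  ∂(α,β) ≤ k  (there is a walk of length ≤ k)
  reach : ℕ → Fin N → Fin N → Bool
  reach zero    α β = ⌊ α Fin.≟ β ⌋
  reach (suc k) α β = reach k α β ∨ anyFin (λ γ → reach k α γ ∧ adj G γ β)

  isDist : ℕ → Fin N → Fin N → Bool
  isDist zero    α β = reach zero α β
  isDist (suc i) α β = reach (suc i) α β ∧ not (reach i α β)

  -- ∂(α,β) = i - 1   (false for i = 0)
  isDistPred : ℕ → Fin N → Fin N → Bool
  isDistPred zero    α β = false
  isDistPred (suc i) α β = isDist i α β

  Connected : Set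
  Connected = ∀ α β → ∃ λ i → isDist i α β ≡ true

  HasDiameter : ℕ → Set
  HasDiameter d = (∀ α β i → isDist i α β ≡ true → i ≤ d)
                × Σ (Fin N) λ α → Σ (Fin N) λ β → isDist d α β ≡ true

  IsDistanceRegular : (b a c : ℕ → ℕ) → Set
  IsDistanceRegular b a c = ∀ α β i → isDist i α β ≡ true →
      (countFin (λ γ → isDistPred i α γ ∧ adj G γ β) ≡ c i)
    × (countFin (λ γ → isDist i α γ ∧ adj G γ β) ≡ a i)
    × (countFin (λ γ → isDist (suc i) α γ ∧ adj G γ β) ≡ b i)

  HasValencies : (ℕ → ℕ) → Set
  HasValencies kv = ∀ α l → countFin (isDist l α) ≡ kv l

Mat : ℕ → Set
Mat N = Fin N → Fin N → ℚ

_⊗_ : ∀ {N} → Mat N → Mat N → Mat N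
(A ⊗ B) i j = sumQ (λ k → A i k * B k j)

transpose : ∀ {N} → Mat N → Mat N
transpose A i j = A j i

laplacian : ∀ {N} → SimpleGraph N → ℚ → Mat N
laplacian G κ x y =
  if ⌊ x Fin.≟ y ⌋ then κ else (if adj G x y then - 1ℚ else 0ℚ)

record IsMoorePenrose {N : ℕ} (L X : Mat N) : Set where
  field
    p1 : ∀ i j → ((L ⊗ X) ⊗ L) i j ≡ L i j
    p2 : ∀ i j → ((X ⊗ L) ⊗ X) i j ≡ X i j
    p3 : ∀ i j → transpose (L ⊗ X) i j ≡ (L ⊗ X) i j
    p4 : ∀ i j → transpose (X ⊗ L) i j ≡ (X ⊗ L) i j

resistance : ∀ {N} → Mat N → Fin N → Fin N → ℚ
resistance Lp α β = Lp α α + Lp β β - Lp α β - Lp β α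

module Submission where

-- For a distance-regular graph Γ the Laplacian L = κI − A maps a
-- function of the distance ∂(x,·) to a function of the distance, acting on
-- the sequence (φ 0, …, φ d) through the tridiagonal intersection matrix.
-- Solving that three-term recursion with right-hand side δ₀ − 1/N gives an
-- explicit radial Green function: φ 0 = 0 and φ(l+1) = φ l − D l with
-- D l = (N − κ₀ − … − κ_l)/(N κ_l b_l); the matrix Φ with entries
-- φ(∂(x,k)) then satisfies  L Φ = Φᵀ L = I − J/N.  A purely linear-algebraic
-- lemma identifies the Moore–Penrose inverse of any L with constant kernel
-- and such a centred Green matrix, so L⁺ = Φ − cJ, and the resistance
-- R(α,γ) = 2 (φ 0 − φ ∂(α,γ)) increases by exactly 2 D m from distance m to
-- m + 1.  D m > 0 below the diameter because the ball of radius m misses a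
-- vertex.

module ResistanceDistance where

  open import Defs
  open import Algebra.Bundles using (CommutativeRing)
  open import Data.Bool using (Bool; true; false; _∧_; _∨_; not; if_then_else_)
  open import Data.Bool.Properties using (∧-identityʳ; ∧-zeroʳ; ∨-zeroʳ; not-involutive)
  open import Data.Empty using (⊥-elim)
  open import Data.Fin as Fin using (Fin; zero; suc)
  open import Data.Fin.Properties using (toℕ<n)
  import Data.Integer as ℤ
  import Data.Integer.Properties as ℤ
  open import Data.Nat as ℕ using (ℕ; zero; suc; _≤_; _<_; _∸_; _≤′_; ≤′-refl; ≤′-step; z≤n; s≤s)
  import Data.Nat.Properties as ℕ
  open import Data.Nat.Coprimality using (1-coprimeTo) renaming (sym to coprime-sym)
  open import Data.Product using (Σ; _×_; _,_; proj₁; proj₂)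
  open import Data.Sum using (inj₁; inj₂)
  open import Data.Rational
    using (ℚ; mkℚ; 0ℚ; 1ℚ; _+_; _*_; -_; _-_; 1/_; NonZero; Positive; ↥_; ≢-nonZero) renaming (_<_ to _<ℚ_)
  open import Data.Rational.Properties
    using ( _≟_; normalize-coprime; /-cong; +-identityˡ; +-identityʳ; +-inverseʳ; *-zeroˡ; *-zeroʳ
          ; *-identityˡ; *-identityʳ; *-assoc; *-comm; *-distribʳ-+; *-inverseˡ; *-inverseʳ
          ; positive⁻¹; pos*pos⇒pos; 1/pos⇒pos; +-*-commutativeRing)
  open import Data.Rational.Solver using (module +-*-Solver)
  open import Algebra.Properties.Semiring.Sum (CommutativeRing.semiring +-*-commutativeRing)
    using (sum; sum-cong-≗; ∑-distrib-+; ∑-comm; *-distribˡ-sum; sum-replicate-zero)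
  open import Function using (_∘_)
  open import Relation.Binary.PropositionalEquality
  open import Relation.Binary.Definitions using (tri<; tri≈; tri>)
  open import Relation.Nullary using (Dec; yes; no; ¬_)
  open import Relation.Nullary.Decidable using (⌊_⌋; ⌊⌋-map′; isYes≗does; dec-true; dec-false)
  open +-*-Solver

  ℕtoℚ-mkℚ : ∀ n → ℕtoℚ n ≡ mkℚ (ℤ.+ n) 0 (coprime-sym (1-coprimeTo n))
  ℕtoℚ-mkℚ n = normalize-coprime (coprime-sym (1-coprimeTo n))

  ℕtoℚ-+ : ∀ m n → ℕtoℚ (m ℕ.+ n) ≡ ℕtoℚ m + ℕtoℚ n
  ℕtoℚ-+ m n rewrite ℕtoℚ-mkℚ m | ℕtoℚ-mkℚ n =
    /-cong (sym (cong₂ ℤ._+_ (ℤ.*-identityʳ (ℤ.+ m)) (ℤ.*-identityʳ (ℤ.+ n)))) refl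

  ℕtoℚ-* : ∀ m n → ℕtoℚ (m ℕ.* n) ≡ ℕtoℚ m * ℕtoℚ n
  ℕtoℚ-* m n rewrite ℕtoℚ-mkℚ m | ℕtoℚ-mkℚ n = /-cong (ℤ.pos-* m n) refl

  ℕtoℚ-∸ : ∀ m n → n ≤ m → ℕtoℚ (m ∸ n) ≡ ℕtoℚ m - ℕtoℚ n
  ℕtoℚ-∸ m n n≤m = begin
    ℕtoℚ (m ∸ n)                    ≡⟨ solve 2 (λ x y → x := (x :+ y) :- y) refl (ℕtoℚ (m ∸ n)) (ℕtoℚ n) ⟩
    ℕtoℚ (m ∸ n) + ℕtoℚ n - ℕtoℚ n  ≡⟨ cong (_- ℕtoℚ n) (sym (ℕtoℚ-+ (m ∸ n) n)) ⟩
    ℕtoℚ (m ∸ n ℕ.+ n) - ℕtoℚ n     ≡⟨ cong (λ k → ℕtoℚ k - ℕtoℚ n) (ℕ.m∸n+n≡m n≤m) ⟩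
    ℕtoℚ m - ℕtoℚ n                   ∎
    where open ≡-Reasoning

  ℕtoℚ-injective : ∀ m n → ℕtoℚ m ≡ ℕtoℚ n → m ≡ n
  ℕtoℚ-injective m n e = ℤ.+-injective (cong ↥_ (trans (sym (ℕtoℚ-mkℚ m)) (trans e (ℕtoℚ-mkℚ n))))

  ℕtoℚ-positive : ∀ n → Positive (ℕtoℚ (suc n))
  ℕtoℚ-positive n = subst Positive (sym (ℕtoℚ-mkℚ (suc n))) _

  ℕtoℚ-nonZero : ∀ n → 1 ≤ n → ℕtoℚ n ≢ 0ℚ
  ℕtoℚ-nonZero (suc n) _ e with ℕtoℚ-injective (suc n) 0 e
  ... | ()

  /ᵗ-inverse : ∀ p r → r ≢ 0ℚ → (p /ᵗ r) * r ≡ p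
  /ᵗ-inverse p r r≢0 with r ≟ 0ℚ
  ... | yes r≡0 = ⊥-elim (r≢0 r≡0)
  ... | no r≢0 = trans (*-assoc p (1/ r) r) (trans (cong (p *_) (*-inverseˡ r)) (*-identityʳ p))
    where
    instance
      r-nonZero : NonZero r
      r-nonZero = ≢-nonZero r≢0

  0/ᵗ : ∀ r → 0ℚ /ᵗ r ≡ 0ℚ
  0/ᵗ r with r ≟ 0ℚ
  ... | yes _ = refl
  ... | no r≢0 = *-zeroˡ (1/ r)
    where
    instance
      r-nonZero : NonZero r
      r-nonZero = ≢-nonZero r≢0

  *-/ᵗ-assoc : ∀ c p r → c * (p /ᵗ r) ≡ (c * p) /ᵗ r
  *-/ᵗ-assoc c p r with r ≟ 0ℚ
  ... | yes _ = *-zeroʳ c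
  ... | no r≢0 = sym (*-assoc c p (1/ r))
    where
    instance
      r-nonZero : NonZero r
      r-nonZero = ≢-nonZero r≢0

  /ᵗ-positive : ∀ p q → 1 ≤ p → 1 ≤ q → 0ℚ <ℚ ℕtoℚ p /ᵗ ℕtoℚ q
  /ᵗ-positive (suc p) (suc q) _ _ with ℕtoℚ (suc q) ≟ 0ℚ
  ... | yes q≡0 = ⊥-elim (ℕtoℚ-nonZero (suc q) (s≤s z≤n) q≡0)
  ... | no q≢0 =
    positive⁻¹ (p′ * (1/ q′) {{≢-nonZero q≢0}})
      {{pos*pos⇒pos p′ {{ℕtoℚ-positive p}} ((1/ q′) {{≢-nonZero q≢0}}) {{1/pos⇒pos q′ {{ℕtoℚ-positive q}}}}}}
    where
    p′ q′ : ℚ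
    p′ = ℕtoℚ (suc p)
    q′ = ℕtoℚ (suc q)

  *-cancelʳ : ∀ x y r → r ≢ 0ℚ → x * r ≡ y * r → x ≡ y
  *-cancelʳ x y r r≢0 xr≡yr = begin
    x               ≡⟨ sym (undo x) ⟩
    x * r * (1/ r)  ≡⟨ cong (_* (1/ r)) xr≡yr ⟩
    y * r * (1/ r)  ≡⟨ undo y ⟩
    y               ∎
    where
    open ≡-Reasoning
    instance
      r-nonZero : NonZero r
      r-nonZero = ≢-nonZero r≢0
    undo : ∀ z → z * r * (1/ r) ≡ z
    undo z = trans (*-assoc z r (1/ r)) (trans (cong (z *_) (*-inverseʳ r)) (*-identityʳ z))

  true≢false : true ≢ false
  true≢false ()

  ⌊⌋-yes : ∀ {A : Set} (a? : Dec A) → A → ⌊ a? ⌋ ≡ true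
  ⌊⌋-yes a? a = trans (isYes≗does a?) (dec-true a? a)

  ⌊⌋-no : ∀ {A : Set} (a? : Dec A) → ¬ A → ⌊ a? ⌋ ≡ false
  ⌊⌋-no a? ¬a = trans (isYes≗does a?) (dec-false a? ¬a)

  ⌊⌋-sound : ∀ {A : Set} (a? : Dec A) → ⌊ a? ⌋ ≡ true → A
  ⌊⌋-sound (yes a) _ = a

  ∧-true : ∀ {p q} → p ∧ q ≡ true → (p ≡ true) × (q ≡ true)
  ∧-true {true} {true} _ = refl , refl

  anyFin-intro : ∀ {n} (P : Fin n → Bool) w → P w ≡ true → anyFin P ≡ true
  anyFin-intro P zero    Pw = cong (_∨ anyFin (P ∘ suc)) Pw
  anyFin-intro P (suc w) Pw = trans (cong (P zero ∨_) (anyFin-intro (P ∘ suc) w Pw)) (∨-zeroʳ (P zero))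

  anyFin-elim : ∀ {n} (P : Fin n → Bool) → anyFin P ≡ true → Σ (Fin n) λ w → P w ≡ true
  anyFin-elim {suc n} P any with P zero in P0
  ... | true  = zero , P0
  ... | false = let w , Pw = anyFin-elim (P ∘ suc) any in suc w , Pw

  𝟙 : Bool → ℚ
  𝟙 true  = 1ℚ
  𝟙 false = 0ℚ

  𝟙-∧ : ∀ p q → 𝟙 (p ∧ q) ≡ 𝟙 p * 𝟙 q
  𝟙-∧ true  q = sym (*-identityˡ (𝟙 q))
  𝟙-∧ false q = sym (*-zeroˡ (𝟙 q))

  𝟙-∨ : ∀ p q → 𝟙 (p ∨ q) ≡ 𝟙 p + 𝟙 ((p ∨ q) ∧ not p)
  𝟙-∨ true  q = sym (+-identityʳ 1ℚ)
  𝟙-∨ false q = trans (cong 𝟙 (sym (∧-identityʳ q))) (sym (+-identityˡ _))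

  𝟙-guard : ∀ p {u v} → (p ≡ true → u ≡ v) → 𝟙 p * u ≡ 𝟙 p * v
  𝟙-guard true  u≡v = cong (1ℚ *_) (u≡v refl)
  𝟙-guard false {u} {v} _ = trans (*-zeroˡ u) (sym (*-zeroˡ v))

  sumQ-sum : ∀ {n} (f : Fin n → ℚ) → sumQ f ≡ sum f
  sumQ-sum {zero}  f = refl
  sumQ-sum {suc n} f = cong (f zero +_) (sumQ-sum (f ∘ suc))

  sumQ-cong : ∀ {n} {f g : Fin n → ℚ} → (∀ i → f i ≡ g i) → sumQ f ≡ sumQ g
  sumQ-cong {f = f} {g} f≗g = trans (sumQ-sum f) (trans (sum-cong-≗ f≗g) (sym (sumQ-sum g)))

  sumQ-zero : ∀ n → sumQ {n} (λ _ → 0ℚ) ≡ 0ℚ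
  sumQ-zero n = trans (sumQ-sum {n} (λ _ → 0ℚ)) (sum-replicate-zero n)

  sumQ-+ : ∀ {n} (f g : Fin n → ℚ) → sumQ (λ i → f i + g i) ≡ sumQ f + sumQ g
  sumQ-+ f g = trans (sumQ-sum (λ i → f i + g i))
    (trans (∑-distrib-+ f g) (sym (cong₂ _+_ (sumQ-sum f) (sumQ-sum g))))

  sumQ-*ˡ : ∀ {n} c (f : Fin n → ℚ) → sumQ (λ i → c * f i) ≡ c * sumQ f
  sumQ-*ˡ c f = trans (sumQ-sum (λ i → c * f i)) (trans (sym (*-distribˡ-sum c f)) (cong (c *_) (sym (sumQ-sum f))))

  sumQ-*ʳ : ∀ {n} c (f : Fin n → ℚ) → sumQ (λ i → f i * c) ≡ sumQ f * c
  sumQ-*ʳ c f = trans (sumQ-cong (λ i → *-comm (f i) c)) (trans (sumQ-*ˡ c f) (*-comm c (sumQ f)))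

  sumQ-- : ∀ {n} (f g : Fin n → ℚ) → sumQ (λ i → f i - g i) ≡ sumQ f - sumQ g
  sumQ-- f g = begin
    sumQ (λ i → f i - g i)              ≡⟨ sumQ-cong (λ i → solve 2 (λ x y → x :- y := x :+ con (- 1ℚ) :* y) refl (f i) (g i)) ⟩
    sumQ (λ i → f i + - 1ℚ * g i)       ≡⟨ sumQ-+ f _ ⟩
    sumQ f + sumQ (λ i → - 1ℚ * g i)    ≡⟨ cong (sumQ f +_) (sumQ-*ˡ (- 1ℚ) g) ⟩
    sumQ f + - 1ℚ * sumQ g              ≡⟨ solve 2 (λ x y → x :+ con (- 1ℚ) :* y := x :- y) refl (sumQ f) (sumQ g) ⟩
    sumQ f - sumQ g                     ∎
    where open ≡-Reasoning

  sumQ-swap : ∀ {m n} (f : Fin m → Fin n → ℚ) →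
    sumQ (λ i → sumQ (λ j → f i j)) ≡ sumQ (λ j → sumQ (λ i → f i j))
  sumQ-swap f = begin
    sumQ (λ i → sumQ (f i))            ≡⟨ trans (sumQ-cong (λ i → sumQ-sum (f i))) (sumQ-sum (λ i → sum (f i))) ⟩
    sum (λ i → sum (f i))              ≡⟨ ∑-comm f ⟩
    sum (λ j → sum (λ i → f i j))
      ≡⟨ sym (trans (sumQ-cong (λ j → sumQ-sum (λ i → f i j))) (sumQ-sum (λ j → sum (λ i → f i j)))) ⟩
    sumQ (λ j → sumQ (λ i → f i j))    ∎
    where open ≡-Reasoning

  sumQ-δ : ∀ {n} (j : Fin n) (f : Fin n → ℚ) → sumQ (λ k → 𝟙 ⌊ j Fin.≟ k ⌋ * f k) ≡ f j
  sumQ-δ {suc n} zero f = begin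
    1ℚ * f zero + sumQ (λ k → 0ℚ * f (suc k))
      ≡⟨ cong₂ _+_ (*-identityˡ (f zero)) (trans (sumQ-cong (λ k → *-zeroˡ (f (suc k)))) (sumQ-zero n)) ⟩
    f zero + 0ℚ ≡⟨ +-identityʳ (f zero) ⟩
    f zero ∎
    where open ≡-Reasoning
  sumQ-δ {suc n} (suc j) f = begin
    0ℚ * f zero + sumQ (λ k → 𝟙 ⌊ suc j Fin.≟ suc k ⌋ * f (suc k))
      ≡⟨ cong₂ _+_ (*-zeroˡ (f zero)) (sumQ-cong (λ k → cong (λ b → 𝟙 b * f (suc k)) (⌊⌋-map′ _ _ (j Fin.≟ k)))) ⟩
    0ℚ + sumQ (λ k → 𝟙 ⌊ j Fin.≟ k ⌋ * f (suc k))
      ≡⟨ trans (+-identityˡ _) (sumQ-δ j (f ∘ suc)) ⟩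
    f (suc j) ∎
    where open ≡-Reasoning

  sumQ-count : ∀ {n} (P : Fin n → Bool) → sumQ (λ k → 𝟙 (P k)) ≡ ℕtoℚ (countFin P)
  sumQ-count {zero}  P = refl
  sumQ-count {suc n} P = begin
    𝟙 (P zero) + sumQ (λ k → 𝟙 (P (suc k)))
      ≡⟨ cong₂ _+_ (head-count (P zero)) (sumQ-count (P ∘ suc)) ⟩
    ℕtoℚ (if P zero then 1 else 0) + ℕtoℚ (countFin (P ∘ suc))
      ≡⟨ sym (ℕtoℚ-+ (if P zero then 1 else 0) _) ⟩
    ℕtoℚ (countFin P) ∎
    where
    open ≡-Reasoning
    head-count : ∀ b → 𝟙 b ≡ ℕtoℚ (if b then 1 else 0)
    head-count true  = refl
    head-count false = refl

  sumQ-restrict : ∀ {n} (P : Fin n → Bool) (f : Fin n → ℚ) c →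
    (∀ k → P k ≡ true → f k ≡ c) → sumQ (λ k → 𝟙 (P k) * f k) ≡ ℕtoℚ (countFin P) * c
  sumQ-restrict P f c const = begin
    sumQ (λ k → 𝟙 (P k) * f k)  ≡⟨ sumQ-cong (λ k → 𝟙-guard (P k) (const k)) ⟩
    sumQ (λ k → 𝟙 (P k) * c)    ≡⟨ sumQ-*ʳ c (λ k → 𝟙 (P k)) ⟩
    sumQ (λ k → 𝟙 (P k)) * c    ≡⟨ cong (_* c) (sumQ-count P) ⟩
    ℕtoℚ (countFin P) * c       ∎
    where open ≡-Reasoning

  countFin-all : ∀ n → countFin {n} (λ _ → true) ≡ n
  countFin-all zero    = refl
  countFin-all (suc n) = cong suc (countFin-all n)

  countFin-pos : ∀ {n} (P : Fin n → Bool) w → P w ≡ true → 1 ≤ countFin P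
  countFin-pos P zero    Pw rewrite Pw = s≤s z≤n
  countFin-pos P (suc w) Pw = ℕ.≤-trans (countFin-pos (P ∘ suc) w Pw) (ℕ.m≤n+m _ (if P zero then 1 else 0))

  sumQ-double-count : ∀ {n} (A B : Fin n → Bool) (E : Fin n → Fin n → Bool) → (∀ x y → E x y ≡ E y x) →
    sumQ (λ x → 𝟙 (A x) * sumQ (λ y → 𝟙 (B y ∧ E y x))) ≡ sumQ (λ y → 𝟙 (B y) * sumQ (λ x → 𝟙 (A x ∧ E x y)))
  sumQ-double-count A B E E-sym = begin
    sumQ (λ x → 𝟙 (A x) * sumQ (λ y → 𝟙 (B y ∧ E y x)))
      ≡⟨ sumQ-cong (λ x → sym (sumQ-*ˡ (𝟙 (A x)) (λ y → 𝟙 (B y ∧ E y x)))) ⟩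
    sumQ (λ x → sumQ (λ y → 𝟙 (A x) * 𝟙 (B y ∧ E y x)))
      ≡⟨ sumQ-swap (λ x y → 𝟙 (A x) * 𝟙 (B y ∧ E y x)) ⟩
    sumQ (λ y → sumQ (λ x → 𝟙 (A x) * 𝟙 (B y ∧ E y x)))
      ≡⟨ sumQ-cong (λ y → sumQ-cong (λ x → edge x y)) ⟩
    sumQ (λ y → sumQ (λ x → 𝟙 (B y) * 𝟙 (A x ∧ E x y)))
      ≡⟨ sumQ-cong (λ y → sumQ-*ˡ (𝟙 (B y)) (λ x → 𝟙 (A x ∧ E x y))) ⟩
    sumQ (λ y → 𝟙 (B y) * sumQ (λ x → 𝟙 (A x ∧ E x y))) ∎
    where
    open ≡-Reasoning
    edge : ∀ x y → 𝟙 (A x) * 𝟙 (B y ∧ E y x) ≡ 𝟙 (B y) * 𝟙 (A x ∧ E x y)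
    edge x y rewrite E-sym y x | 𝟙-∧ (B y) (E x y) | 𝟙-∧ (A x) (E x y) =
      solve 3 (λ a b e → a :* (b :* e) := b :* (a :* e)) refl (𝟙 (A x)) (𝟙 (B y)) (𝟙 (E x y))

  sumUpToQ : ℕ → (ℕ → ℚ) → ℚ
  sumUpToQ zero    f = f 0
  sumUpToQ (suc n) f = sumUpToQ n f + f (suc n)

  sumUpToQ-ℕtoℚ : ∀ n (f : ℕ → ℕ) → sumUpToQ n (λ l → ℕtoℚ (f l) * 1ℚ) ≡ ℕtoℚ (sumUpTo n f)
  sumUpToQ-ℕtoℚ zero    f = *-identityʳ (ℕtoℚ (f 0))
  sumUpToQ-ℕtoℚ (suc n) f =
    trans (cong₂ _+_ (sumUpToQ-ℕtoℚ n f) (*-identityʳ (ℕtoℚ (f (suc n))))) (sym (ℕtoℚ-+ (sumUpTo n f) (f (suc n))))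

  sumUpTo-mono : ∀ (f : ℕ → ℕ) {m n} → m ≤′ n → sumUpTo m f ≤ sumUpTo n f
  sumUpTo-mono f ≤′-refl = ℕ.≤-refl
  sumUpTo-mono f {n = suc n} (≤′-step m≤n) = ℕ.≤-trans (sumUpTo-mono f m≤n) (ℕ.m≤m+n (sumUpTo n f) (f (suc n)))

  ⊗-congˡ : ∀ {N} {A A′ : Mat N} (B : Mat N) → (∀ i j → A i j ≡ A′ i j) →
    ∀ i j → (A ⊗ B) i j ≡ (A′ ⊗ B) i j
  ⊗-congˡ B A≡A′ i j = sumQ-cong (λ k → cong (_* B k j) (A≡A′ i k))

  ⊗-congʳ : ∀ {N} (A : Mat N) {B B′ : Mat N} → (∀ i j → B i j ≡ B′ i j) →
    ∀ i j → (A ⊗ B) i j ≡ (A ⊗ B′) i j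
  ⊗-congʳ A B≡B′ i j = sumQ-cong (λ k → cong (A i k *_) (B≡B′ k j))

  ⊗-assoc : ∀ {N} (A B C : Mat N) i j → ((A ⊗ B) ⊗ C) i j ≡ (A ⊗ (B ⊗ C)) i j
  ⊗-assoc A B C i j = begin
    sumQ (λ k → sumQ (λ l → A i l * B l k) * C k j)    ≡⟨ sumQ-cong (λ k → sym (sumQ-*ʳ (C k j) (λ l → A i l * B l k))) ⟩
    sumQ (λ k → sumQ (λ l → A i l * B l k * C k j))    ≡⟨ sumQ-swap (λ k l → A i l * B l k * C k j) ⟩
    sumQ (λ l → sumQ (λ k → A i l * B l k * C k j))    ≡⟨ sumQ-cong (λ l → sumQ-cong (λ k → *-assoc (A i l) (B l k) (C k j))) ⟩
    sumQ (λ l → sumQ (λ k → A i l * (B l k * C k j)))  ≡⟨ sumQ-cong (λ l → sumQ-*ˡ (A i l) (λ k → B l k * C k j)) ⟩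
    sumQ (λ l → A i l * sumQ (λ k → B l k * C k j))    ∎
    where open ≡-Reasoning

  IsSymmetric : ∀ {N} → Mat N → Set
  IsSymmetric A = ∀ i j → A i j ≡ A j i

  ⊗-transpose : ∀ {N} {A B : Mat N} → IsSymmetric A → IsSymmetric B →
    ∀ i j → (A ⊗ B) i j ≡ (B ⊗ A) j i
  ⊗-transpose {A = A} {B} A-sym B-sym i j =
    sumQ-cong (λ k → trans (cong₂ _*_ (A-sym i k) (B-sym k j)) (*-comm (A k i) (B j k)))

  ≟-sym : ∀ {n} (i j : Fin n) → ⌊ i Fin.≟ j ⌋ ≡ ⌊ j Fin.≟ i ⌋
  ≟-sym i j with i Fin.≟ j | j Fin.≟ i
  ... | yes refl | yes _    = refl
  ... | yes refl | no j≢i   = ⊥-elim (j≢i refl)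
  ... | no i≢j   | yes refl = ⊥-elim (i≢j refl)
  ... | no _     | no _     = refl

  -- The centring matrix  I − w J  (for w = 1/N the projection orthogonal to
  -- the constants); multiplying by it subtracts w times a column or row sum.
  centring : ∀ {N} → ℚ → Mat N
  centring w i j = 𝟙 ⌊ i Fin.≟ j ⌋ - w

  centring-sym : ∀ {N} w → IsSymmetric (centring {N} w)
  centring-sym w i j = cong (λ b → 𝟙 b - w) (≟-sym i j)

  centring-left : ∀ {N} w (A : Mat N) i j → (centring w ⊗ A) i j ≡ A i j - w * sumQ (λ k → A k j)
  centring-left w A i j = begin
    sumQ (λ k → (𝟙 ⌊ i Fin.≟ k ⌋ - w) * A k j)
      ≡⟨ sumQ-cong (λ k → solve 3 (λ e v a → (e :- v) :* a := e :* a :- v :* a) refl (𝟙 ⌊ i Fin.≟ k ⌋) w (A k j)) ⟩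
    sumQ (λ k → 𝟙 ⌊ i Fin.≟ k ⌋ * A k j - w * A k j)
      ≡⟨ sumQ-- (λ k → 𝟙 ⌊ i Fin.≟ k ⌋ * A k j) (λ k → w * A k j) ⟩
    sumQ (λ k → 𝟙 ⌊ i Fin.≟ k ⌋ * A k j) - sumQ (λ k → w * A k j)
      ≡⟨ cong₂ _-_ (sumQ-δ i (λ k → A k j)) (sumQ-*ˡ w (λ k → A k j)) ⟩
    A i j - w * sumQ (λ k → A k j) ∎
    where open ≡-Reasoning

  centring-right : ∀ {N} w (A : Mat N) i j → (A ⊗ centring w) i j ≡ A i j - w * sumQ (λ k → A i k)
  centring-right w A i j = begin
    (A ⊗ centring w) i j
      ≡⟨ sumQ-cong (λ k → trans (*-comm (A i k) _) (cong (_* A i k) (centring-sym w k j))) ⟩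
    (centring w ⊗ (λ k l → A l k)) j i
      ≡⟨ centring-left w (λ k l → A l k) j i ⟩
    A i j - w * sumQ (λ k → A i k) ∎
    where open ≡-Reasoning

  centring-unique : ∀ {N} w (A : Mat N) → IsSymmetric A → (∀ j → sumQ (λ k → A k j) ≡ 0ℚ) →
    (∀ i j → (A ⊗ centring w) i j ≡ centring w i j) → ∀ i j → A i j ≡ centring w i j
  centring-unique w A A-sym A-cols AM≡M i j = begin
    A i j                              ≡⟨ solve 2 (λ a v → a := a :- v :* con 0ℚ) refl (A i j) w ⟩
    A i j - w * 0ℚ                     ≡⟨ cong (λ s → A i j - w * s) (sym (A-cols j)) ⟩
    A i j - w * sumQ (λ k → A k j)     ≡⟨ sym (centring-left w A i j) ⟩
    (centring w ⊗ A) i j               ≡⟨ ⊗-transpose (centring-sym w) A-sym i j ⟩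
    (A ⊗ centring w) j i               ≡⟨ AM≡M j i ⟩
    centring w j i                     ≡⟨ centring-sym w j i ⟩
    centring w i j                     ∎
    where open ≡-Reasoning

  -- If L annihilates the constants on both sides and has a right inverse G and a
  -- left inverse H modulo the centring matrix M = I − w J, then its Moore–Penrose
  -- inverse X is the centred form of G and of H:  L X = X L = M,  X = M G = H M.
  module CentredInverse {N} (L G H X : Mat N) (w : ℚ)
    (L-rows : ∀ i → sumQ (λ k → L i k) ≡ 0ℚ) (L-cols : ∀ j → sumQ (λ k → L k j) ≡ 0ℚ)
    (LG≡M : ∀ i j → (L ⊗ G) i j ≡ centring w i j) (HL≡M : ∀ i j → (H ⊗ L) i j ≡ centring w i j)
    (X-pinv : IsMoorePenrose L X) where

    open IsMoorePenrose X-pinv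
    open ≡-Reasoning

    M : Mat N
    M = centring w

    LX≡M : ∀ i j → (L ⊗ X) i j ≡ M i j
    LX≡M = centring-unique w (L ⊗ X) (λ i j → sym (p3 i j)) LX-cols LXM≡M
      where
      LX-cols : ∀ j → sumQ (λ k → (L ⊗ X) k j) ≡ 0ℚ
      LX-cols j = begin
        sumQ (λ k → sumQ (λ l → L k l * X l j))  ≡⟨ sumQ-swap (λ k l → L k l * X l j) ⟩
        sumQ (λ l → sumQ (λ k → L k l * X l j))  ≡⟨ sumQ-cong (λ l → sumQ-*ʳ (X l j) (λ k → L k l)) ⟩
        sumQ (λ l → sumQ (λ k → L k l) * X l j)  ≡⟨ sumQ-cong (λ l → trans (cong (_* X l j) (L-cols l)) (*-zeroˡ (X l j))) ⟩
        sumQ {N} (λ _ → 0ℚ)                      ≡⟨ sumQ-zero N ⟩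
        0ℚ                                       ∎
      LXM≡M : ∀ i j → ((L ⊗ X) ⊗ M) i j ≡ M i j
      LXM≡M i j = begin
        ((L ⊗ X) ⊗ M) i j         ≡⟨ ⊗-congʳ (L ⊗ X) (λ k l → sym (LG≡M k l)) i j ⟩
        ((L ⊗ X) ⊗ (L ⊗ G)) i j   ≡⟨ sym (⊗-assoc (L ⊗ X) L G i j) ⟩
        (((L ⊗ X) ⊗ L) ⊗ G) i j   ≡⟨ ⊗-congˡ G p1 i j ⟩
        (L ⊗ G) i j               ≡⟨ LG≡M i j ⟩
        M i j                     ∎

    XL≡M : ∀ i j → (X ⊗ L) i j ≡ M i j
    XL≡M = centring-unique w (X ⊗ L) XL-sym XL-cols XLM≡M
      where
      XL-sym : IsSymmetric (X ⊗ L)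
      XL-sym i j = sym (p4 i j)
      XL-cols : ∀ j → sumQ (λ k → (X ⊗ L) k j) ≡ 0ℚ
      XL-cols j = begin
        sumQ (λ k → (X ⊗ L) k j)                 ≡⟨ sumQ-cong (λ k → XL-sym k j) ⟩
        sumQ (λ k → sumQ (λ l → X j l * L l k))  ≡⟨ sumQ-swap (λ k l → X j l * L l k) ⟩
        sumQ (λ l → sumQ (λ k → X j l * L l k))  ≡⟨ sumQ-cong (λ l → sumQ-*ˡ (X j l) (λ k → L l k)) ⟩
        sumQ (λ l → X j l * sumQ (λ k → L l k))  ≡⟨ sumQ-cong (λ l → trans (cong (X j l *_) (L-rows l)) (*-zeroʳ (X j l))) ⟩
        sumQ {N} (λ _ → 0ℚ)                      ≡⟨ sumQ-zero N ⟩
        0ℚ                                       ∎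
      XLM≡M : ∀ i j → ((X ⊗ L) ⊗ M) i j ≡ M i j
      XLM≡M i j = begin
        ((X ⊗ L) ⊗ M) i j         ≡⟨ ⊗-transpose XL-sym (centring-sym w) i j ⟩
        (M ⊗ (X ⊗ L)) j i         ≡⟨ ⊗-congˡ (X ⊗ L) (λ k l → sym (HL≡M k l)) j i ⟩
        ((H ⊗ L) ⊗ (X ⊗ L)) j i   ≡⟨ ⊗-assoc H L (X ⊗ L) j i ⟩
        (H ⊗ (L ⊗ (X ⊗ L))) j i   ≡⟨ ⊗-congʳ H (λ k l → trans (sym (⊗-assoc L X L k l)) (p1 k l)) j i ⟩
        (H ⊗ L) j i               ≡⟨ HL≡M j i ⟩
        M j i                     ≡⟨ centring-sym w j i ⟩
        M i j                     ∎

    pinv-via-left : ∀ i j → X i j ≡ H i j - w * sumQ (λ k → H i k)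
    pinv-via-left i j = begin
      X i j                    ≡⟨ sym (p2 i j) ⟩
      ((X ⊗ L) ⊗ X) i j        ≡⟨ ⊗-congˡ X (λ k l → trans (XL≡M k l) (sym (HL≡M k l))) i j ⟩
      ((H ⊗ L) ⊗ X) i j        ≡⟨ ⊗-assoc H L X i j ⟩
      (H ⊗ (L ⊗ X)) i j        ≡⟨ ⊗-congʳ H LX≡M i j ⟩
      (H ⊗ M) i j              ≡⟨ centring-right w H i j ⟩
      H i j - w * sumQ (λ k → H i k) ∎

    pinv-via-right : ∀ i j → X i j ≡ G i j - w * sumQ (λ k → G k j)
    pinv-via-right i j = begin
      X i j                    ≡⟨ sym (p2 i j) ⟩
      ((X ⊗ L) ⊗ X) i j        ≡⟨ ⊗-assoc X L X i j ⟩
      (X ⊗ (L ⊗ X)) i j        ≡⟨ ⊗-congʳ X (λ k l → trans (LX≡M k l) (sym (LG≡M k l))) i j ⟩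
      (X ⊗ (L ⊗ G)) i j        ≡⟨ sym (⊗-assoc X L G i j) ⟩
      ((X ⊗ L) ⊗ G) i j        ≡⟨ ⊗-congˡ G XL≡M i j ⟩
      (M ⊗ G) i j              ≡⟨ centring-left w G i j ⟩
      G i j - w * sumQ (λ k → G k j) ∎

  module Walks {N : ℕ} (G : SimpleGraph N) where

    reach-suc : ∀ {k α β} → reach G k α β ≡ true → reach G (suc k) α β ≡ true
    reach-suc {k} {α} {β} r = cong (_∨ anyFin (λ γ → reach G k α γ ∧ adj G γ β)) r

    reach-mono : ∀ {k k′ α β} → k ≤′ k′ → reach G k α β ≡ true → reach G k′ α β ≡ true
    reach-mono ≤′-refl      r = r
    reach-mono (≤′-step {k′} le) r = reach-suc {k′} (reach-mono le r)

    reach-adj : ∀ {k α δ β} → reach G k α δ ≡ true → adj G δ β ≡ true → reach G (suc k) α β ≡ true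
    reach-adj {k} {α} {δ} {β} r a =
      trans (cong (reach G k α β ∨_) (anyFin-intro (λ γ → reach G k α γ ∧ adj G γ β) δ (cong₂ _∧_ r a)))
            (∨-zeroʳ (reach G k α β))

    isDist⇒reach : ∀ i {α β} → isDist G i α β ≡ true → reach G i α β ≡ true
    isDist⇒reach zero    e = e
    isDist⇒reach (suc i) e = proj₁ (∧-true e)

    reach⇒isDist : ∀ k {α β} → reach G k α β ≡ true → Σ ℕ λ i → i ≤ k × isDist G i α β ≡ true
    reach⇒isDist zero r = 0 , z≤n , r
    reach⇒isDist (suc k) {α} {β} r with reach G k α β in rk
    ... | true  = let i , i≤k , e = reach⇒isDist k rk in i , ℕ.m≤n⇒m≤1+n i≤k , e
    ... | false = suc k , ℕ.≤-refl , subst (λ y → (y ∨ step) ∧ not y ≡ true) (sym rk) (trans (∧-identityʳ step) r)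
      where
      step : Bool
      step = anyFin (λ γ → reach G k α γ ∧ adj G γ β)

    isDist⇒unreached : ∀ i {α β} → isDist G (suc i) α β ≡ true → reach G i α β ≡ false
    isDist⇒unreached i {α} {β} e =
      trans (sym (not-involutive (reach G i α β))) (cong not (proj₂ (∧-true {reach G (suc i) α β} e)))

    isDist-earlier : ∀ i j {α β} → isDist G i α β ≡ true → i ≤ j → isDist G (suc j) α β ≡ false
    isDist-earlier i j {α} {β} ei i≤j =
      trans (cong (λ r → reach G (suc j) α β ∧ not r) (reach-mono (ℕ.≤⇒≤′ i≤j) (isDist⇒reach i ei)))
            (∧-zeroʳ (reach G (suc j) α β))

    isDist-unique : ∀ i j {α β} → isDist G i α β ≡ true → isDist G j α β ≡ true → i ≡ j
    isDist-unique i j ei ej with ℕ.<-cmp i j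
    ... | tri≈ _ i≡j _ = i≡j
    isDist-unique i (suc j) ei ej | tri< i<j _ _ = ⊥-elim (true≢false (trans (sym ej) (isDist-earlier i j ei (ℕ.≤-pred i<j))))
    isDist-unique (suc i) j ei ej | tri> _ _ j<i = ⊥-elim (true≢false (trans (sym ei) (isDist-earlier j i ej (ℕ.≤-pred j<i))))

  module Distance {N : ℕ} (G : SimpleGraph N) (conn : Connected G) where
    open Walks G public

    dist : Fin N → Fin N → ℕ
    dist α β = proj₁ (conn α β)

    dist-spec : ∀ α β → isDist G (dist α β) α β ≡ true
    dist-spec α β = proj₂ (conn α β)

    dist-unique : ∀ {i α β} → isDist G i α β ≡ true → i ≡ dist α β
    dist-unique {i} e = isDist-unique i _ e (dist-spec _ _)

    isDist≡ : ∀ i α β → isDist G i α β ≡ ⌊ i ℕ.≟ dist α β ⌋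
    isDist≡ i α β with isDist G i α β in e
    ... | true  = sym (⌊⌋-yes (i ℕ.≟ dist α β) (dist-unique e))
    ... | false = sym (⌊⌋-no (i ℕ.≟ dist α β) (λ { refl → true≢false (trans (sym (dist-spec α β)) e) }))

    dist-self : ∀ α → dist α α ≡ 0
    dist-self α = sym (dist-unique (⌊⌋-yes (α Fin.≟ α) refl))

    reach⇒dist≤ : ∀ {k α β} → reach G k α β ≡ true → dist α β ≤ k
    reach⇒dist≤ {k} r = let i , i≤k , e = reach⇒isDist k r in subst (_≤ k) (dist-unique e) i≤k

    dist≤⇒reach : ∀ {k α β} → dist α β ≤ k → reach G k α β ≡ true
    dist≤⇒reach {k} {α} {β} le = reach-mono (ℕ.≤⇒≤′ le) (isDist⇒reach (dist α β) (dist-spec α β))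

    dist-step : ∀ α {δ β} → adj G δ β ≡ true → dist α β ≤ suc (dist α δ)
    dist-step α {δ} {β} a = reach⇒dist≤ (reach-adj {dist α δ} {α} {δ} {β} (dist≤⇒reach ℕ.≤-refl) a)

    adj⇒dist≡1 : ∀ {α β} → adj G α β ≡ true → dist α β ≡ 1
    adj⇒dist≡1 {α} {β} a with dist α β in e | dist-step α {α} a
    ... | suc zero    | _ = refl
    ... | suc (suc _) | s≤s le rewrite dist-self α = ⊥-elim (ℕ.1+n≰n (ℕ.≤-trans le z≤n))
    ... | zero        | _ = ⊥-elim (true≢false (trans (sym a) (trans (cong (adj G α) (sym α≡β)) (adj-irrefl G α))))
      where
      α≡β : α ≡ β
      α≡β = ⌊⌋-sound (α Fin.≟ β) (subst (λ i → isDist G i α β ≡ true) e (dist-spec α β))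

    predecessor : ∀ i {α β} → isDist G (suc i) α β ≡ true →
      Σ (Fin N) λ δ → isDist G i α δ ≡ true × adj G δ β ≡ true
    predecessor i {α} {β} e = δ , subst (λ j → isDist G j α δ ≡ true) δ-at-i (dist-spec α δ) , adj-δβ
      where
      step : Bool
      step = anyFin (λ γ → reach G i α γ ∧ adj G γ β)
      stepped : step ≡ true
      stepped = trans (sym (cong (_∨ step) (isDist⇒unreached i e))) (isDist⇒reach (suc i) e)
      found : Σ (Fin N) λ γ → reach G i α γ ∧ adj G γ β ≡ true
      found = anyFin-elim (λ γ → reach G i α γ ∧ adj G γ β) stepped
      δ : Fin N
      δ = proj₁ found
      adj-δβ : adj G δ β ≡ true
      adj-δβ = proj₂ (∧-true (proj₂ found))
      δ-at-i : dist α δ ≡ i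
      δ-at-i = ℕ.≤-antisym (reach⇒dist≤ (proj₁ (∧-true (proj₂ found))))
                 (ℕ.≤-pred (subst (_≤ suc (dist α δ)) (sym (dist-unique e)) (dist-step α adj-δβ)))

    sphere-nonempty : ∀ {i n α β} → i ≤′ n → isDist G n α β ≡ true → Σ (Fin N) λ γ → isDist G i α γ ≡ true
    sphere-nonempty {β = β} ≤′-refl e = β , e
    sphere-nonempty {n = suc n} (≤′-step i≤n) e = sphere-nonempty i≤n (proj₁ (proj₂ (predecessor n e)))

  n≢1+n : ∀ n → n ≢ suc n
  n≢1+n n = ℕ.<⇒≢ (ℕ.n<1+n n)

  n≢2+n : ∀ n → n ≢ suc (suc n)
  n≢2+n n = ℕ.<⇒≢ (ℕ.<-trans (ℕ.n<1+n n) (ℕ.n<1+n (suc n)))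

  isPred : ℕ → ℕ → Bool
  isPred zero    l = false
  isPred (suc i) l = ⌊ i ℕ.≟ l ⌋

  isPred-self : ∀ i → isPred i i ≡ false
  isPred-self zero    = refl
  isPred-self (suc i) = ⌊⌋-no (i ℕ.≟ suc i) (n≢1+n i)

  isPred-next : ∀ i → isPred i (suc i) ≡ false
  isPred-next zero    = refl
  isPred-next (suc i) = ⌊⌋-no (i ℕ.≟ suc (suc i)) (n≢2+n i)

  -- The value at l of a function on ℕ, expanded over the three candidates
  -- l = i − 1, i, i + 1 (the possible distances of a neighbour).
  threePoint : (ℕ → ℚ) → ℕ → ℕ → ℚ
  threePoint g i l = 𝟙 (isPred i l) * g (i ∸ 1) + 𝟙 ⌊ i ℕ.≟ l ⌋ * g i + 𝟙 ⌊ suc i ℕ.≟ l ⌋ * g (suc i)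

  threePoint-below : ∀ g l → threePoint g (suc l) l ≡ g l
  threePoint-below g l
    rewrite ⌊⌋-yes (l ℕ.≟ l) refl | ⌊⌋-no (suc l ℕ.≟ l) (n≢1+n l ∘ sym) | ⌊⌋-no (suc (suc l) ℕ.≟ l) (n≢2+n l ∘ sym) =
    solve 3 (λ x y z → con 1ℚ :* x :+ con 0ℚ :* y :+ con 0ℚ :* z := x) refl (g l) (g (suc l)) (g (suc (suc l)))

  threePoint-at : ∀ g i → threePoint g i i ≡ g i
  threePoint-at g i rewrite isPred-self i | ⌊⌋-yes (i ℕ.≟ i) refl | ⌊⌋-no (suc i ℕ.≟ i) (n≢1+n i ∘ sym) =
    solve 3 (λ x y z → con 0ℚ :* x :+ con 1ℚ :* y :+ con 0ℚ :* z := y) refl (g (i ∸ 1)) (g i) (g (suc i))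

  threePoint-above : ∀ g i → threePoint g i (suc i) ≡ g (suc i)
  threePoint-above g i rewrite isPred-next i | ⌊⌋-no (i ℕ.≟ suc i) (n≢1+n i) | ⌊⌋-yes (suc i ℕ.≟ suc i) refl =
    solve 3 (λ x y z → con 0ℚ :* x :+ con 0ℚ :* y :+ con 1ℚ :* z := z) refl (g (i ∸ 1)) (g i) (g (suc i))

  threePoint-exact : ∀ g i l → l ≤ suc i → i ≤ suc l → threePoint g i l ≡ g l
  threePoint-exact g i l l≤1+i i≤1+l with ℕ.<-cmp i l
  ... | tri≈ _ refl _ = threePoint-at g i
  ... | tri< i<l _ _ rewrite ℕ.≤-antisym l≤1+i i<l = threePoint-above g i
  ... | tri> _ _ l<i rewrite ℕ.≤-antisym i≤1+l l<i = threePoint-below g l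

  module DistanceRegular {N : ℕ} (G : SimpleGraph N) (d : ℕ) (b a c kv : ℕ → ℕ)
    (conn : Connected G) (diam : HasDiameter G d)
    (drg : IsDistanceRegular G b a c) (val : HasValencies G kv) where

    open Distance G conn public
    open ≡-Reasoning

    α₀ β₀ : Fin N
    α₀ = proj₁ (proj₂ diam)
    β₀ = proj₁ (proj₂ (proj₂ diam))

    α₀β₀-at-d : isDist G d α₀ β₀ ≡ true
    α₀β₀-at-d = proj₂ (proj₂ (proj₂ diam))

    dist≤d : ∀ α β → dist α β ≤ d
    dist≤d α β = proj₁ diam α β (dist α β) (dist-spec α β)

    sphere-sum : ∀ l x (h : ℕ → ℚ) → sumQ (λ k → 𝟙 (isDist G l x k) * h (dist x k)) ≡ ℕtoℚ (kv l) * h l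
    sphere-sum l x h = trans (sumQ-restrict (isDist G l x) (λ k → h (dist x k)) (h l) (λ k e → cong h (sym (dist-unique e))))
                             (cong (λ n → ℕtoℚ n * h l) (val x l))

    ball-sum : ∀ n x (h : ℕ → ℚ) →
      sumQ (λ k → 𝟙 (reach G n x k) * h (dist x k)) ≡ sumUpToQ n (λ l → ℕtoℚ (kv l) * h l)
    ball-sum zero    x h = sphere-sum 0 x h
    ball-sum (suc n) x h = begin
      sumQ (λ k → 𝟙 (reach G (suc n) x k) * h (dist x k))
        ≡⟨ sumQ-cong (λ k → trans (cong (_* h (dist x k)) (𝟙-∨ (reach G n x k) _))
                                  (*-distribʳ-+ (h (dist x k)) (𝟙 (reach G n x k)) _)) ⟩
      sumQ (λ k → 𝟙 (reach G n x k) * h (dist x k) + 𝟙 (isDist G (suc n) x k) * h (dist x k))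
        ≡⟨ sumQ-+ (λ k → 𝟙 (reach G n x k) * h (dist x k)) (λ k → 𝟙 (isDist G (suc n) x k) * h (dist x k)) ⟩
      sumQ (λ k → 𝟙 (reach G n x k) * h (dist x k)) + sumQ (λ k → 𝟙 (isDist G (suc n) x k) * h (dist x k))
        ≡⟨ cong₂ _+_ (ball-sum n x h) (sphere-sum (suc n) x h) ⟩
      sumUpToQ (suc n) (λ l → ℕtoℚ (kv l) * h l) ∎

    -- The ball of radius d is everything: a sum of a function of ∂(x,k) over
    -- all k is independent of x.
    radial-sum : ∀ x (h : ℕ → ℚ) → sumQ (λ k → h (dist x k)) ≡ sumUpToQ d (λ l → ℕtoℚ (kv l) * h l)
    radial-sum x h = begin
      sumQ (λ k → h (dist x k))
        ≡⟨ sumQ-cong (λ k → sym (trans (cong (_* h (dist x k)) (cong 𝟙 (dist≤⇒reach (dist≤d x k)))) (*-identityˡ _))) ⟩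
      sumQ (λ k → 𝟙 (reach G d x k) * h (dist x k))
        ≡⟨ ball-sum d x h ⟩
      sumUpToQ d (λ l → ℕtoℚ (kv l) * h l) ∎

    vertex-count : sumUpTo d kv ≡ N
    vertex-count = ℕtoℚ-injective _ _ (begin
      ℕtoℚ (sumUpTo d kv)                        ≡⟨ sym (sumUpToQ-ℕtoℚ d kv) ⟩
      sumUpToQ d (λ l → ℕtoℚ (kv l) * 1ℚ)        ≡⟨ sym (radial-sum α₀ (λ _ → 1ℚ)) ⟩
      sumQ {N} (λ _ → 𝟙 true)                    ≡⟨ sumQ-count {N} (λ _ → true) ⟩
      ℕtoℚ (countFin {N} (λ _ → true))           ≡⟨ cong ℕtoℚ (countFin-all N) ⟩
      ℕtoℚ N                                     ∎)

    kv₀≡1 : kv 0 ≡ 1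
    kv₀≡1 = ℕtoℚ-injective _ _ (begin
      ℕtoℚ (kv 0)                                  ≡⟨ cong ℕtoℚ (sym (val α₀ 0)) ⟩
      ℕtoℚ (countFin (isDist G 0 α₀))              ≡⟨ sym (sumQ-count (isDist G 0 α₀)) ⟩
      sumQ (λ k → 𝟙 ⌊ α₀ Fin.≟ k ⌋)                ≡⟨ sumQ-cong (λ k → sym (*-identityʳ (𝟙 ⌊ α₀ Fin.≟ k ⌋))) ⟩
      sumQ (λ k → 𝟙 ⌊ α₀ Fin.≟ k ⌋ * 1ℚ)           ≡⟨ sumQ-δ α₀ (λ _ → 1ℚ) ⟩
      1ℚ                                           ∎)

    -- Counting the edges between the spheres of radii i and i+1 around α₀:
    -- κ_i b_i = κ_{i+1} c_{i+1}.
    handshake : ∀ i → ℕtoℚ (kv i) * ℕtoℚ (b i) ≡ ℕtoℚ (kv (suc i)) * ℕtoℚ (c (suc i))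
    handshake i = begin
      ℕtoℚ (kv i) * ℕtoℚ (b i)
        ≡⟨ cong (λ n → ℕtoℚ n * ℕtoℚ (b i)) (sym (val α₀ i)) ⟩
      ℕtoℚ (countFin inner) * ℕtoℚ (b i)
        ≡⟨ sym (sumQ-restrict inner _ (ℕtoℚ (b i)) b-count) ⟩
      sumQ (λ x → 𝟙 (inner x) * sumQ (λ y → 𝟙 (outer y ∧ adj G y x)))
        ≡⟨ sumQ-double-count inner outer (adj G) (adj-sym G) ⟩
      sumQ (λ y → 𝟙 (outer y) * sumQ (λ x → 𝟙 (inner x ∧ adj G x y)))
        ≡⟨ sumQ-restrict outer _ (ℕtoℚ (c (suc i))) c-count ⟩
      ℕtoℚ (countFin outer) * ℕtoℚ (c (suc i))
        ≡⟨ cong (λ n → ℕtoℚ n * ℕtoℚ (c (suc i))) (val α₀ (suc i)) ⟩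
      ℕtoℚ (kv (suc i)) * ℕtoℚ (c (suc i)) ∎
      where
      inner outer : Fin N → Bool
      inner = isDist G i α₀
      outer = isDist G (suc i) α₀
      b-count : ∀ x → inner x ≡ true → sumQ (λ y → 𝟙 (outer y ∧ adj G y x)) ≡ ℕtoℚ (b i)
      b-count x e = trans (sumQ-count (λ y → outer y ∧ adj G y x)) (cong ℕtoℚ (proj₂ (proj₂ (drg α₀ x i e))))
      c-count : ∀ y → outer y ≡ true → sumQ (λ x → 𝟙 (inner x ∧ adj G x y)) ≡ ℕtoℚ (c (suc i))
      c-count y e = trans (sumQ-count (λ x → inner x ∧ adj G x y)) (cong ℕtoℚ (proj₁ (drg α₀ y (suc i) e)))

    kv-pos : ∀ i → i ≤ d → 1 ≤ kv i
    kv-pos i i≤d = let γ , e = sphere-nonempty (ℕ.≤⇒≤′ i≤d) α₀β₀-at-d in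
      subst (1 ≤_) (val α₀ i) (countFin-pos (isDist G i α₀) γ e)

    b-pos : ∀ i → i < d → 1 ≤ b i
    b-pos i i<d = subst (1 ≤_) (proj₂ (proj₂ (drg α₀ δ i δ-at-i)))
        (countFin-pos (λ γ → isDist G (suc i) α₀ γ ∧ adj G γ δ) y (cong₂ _∧_ y-at-i+1 (trans (adj-sym G y δ) adj-δy)))
      where
      far : Σ (Fin N) λ y → isDist G (suc i) α₀ y ≡ true
      far = sphere-nonempty (ℕ.≤⇒≤′ i<d) α₀β₀-at-d
      y : Fin N
      y = proj₁ far
      y-at-i+1 : isDist G (suc i) α₀ y ≡ true
      y-at-i+1 = proj₂ far
      near : Σ (Fin N) λ δ → isDist G i α₀ δ ≡ true × adj G δ y ≡ true
      near = predecessor i y-at-i+1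
      δ : Fin N
      δ = proj₁ near
      δ-at-i : isDist G i α₀ δ ≡ true
      δ-at-i = proj₁ (proj₂ near)
      adj-δy : adj G δ y ≡ true
      adj-δy = proj₂ (proj₂ near)

    N-pos : 1 ≤ N
    N-pos = ℕ.≤-trans (s≤s z≤n) (toℕ<n α₀)

    -- Γ is regular of valency κ = b₀.
    κ : ℚ
    κ = ℕtoℚ (b 0)

    degree : ∀ j → sumQ (λ k → 𝟙 (adj G j k)) ≡ κ
    degree j = begin
      sumQ (λ k → 𝟙 (adj G j k))                    ≡⟨ sumQ-cong (λ k → cong 𝟙 (neighbour k)) ⟩
      sumQ (λ k → 𝟙 (isDist G 1 j k ∧ adj G k j))   ≡⟨ sumQ-count (λ k → isDist G 1 j k ∧ adj G k j) ⟩
      ℕtoℚ (countFin (λ k → isDist G 1 j k ∧ adj G k j))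
        ≡⟨ cong ℕtoℚ (proj₂ (proj₂ (drg j j 0 (⌊⌋-yes (j Fin.≟ j) refl)))) ⟩
      κ ∎
      where
      neighbour : ∀ k → adj G j k ≡ isDist G 1 j k ∧ adj G k j
      neighbour k rewrite adj-sym G k j with adj G j k in a
      ... | true  = sym (trans (∧-identityʳ _) (trans (isDist≡ 1 j k) (⌊⌋-yes (1 ℕ.≟ dist j k) (sym (adj⇒dist≡1 a)))))
      ... | false = sym (∧-zeroʳ _)

    L : Mat N
    L = laplacian G κ

    L-sym : IsSymmetric L
    L-sym i j with i Fin.≟ j | j Fin.≟ i
    ... | yes refl | yes _    = refl
    ... | yes refl | no j≢i   = ⊥-elim (j≢i refl)
    ... | no i≢j   | yes refl = ⊥-elim (i≢j refl)
    ... | no _     | no _     = cong (λ e → if e then - 1ℚ else 0ℚ) (adj-sym G i j)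

    -- (L f)_j = Σ_{k ~ j} (f_j − f_k), since Γ is κ-regular.
    L-apply : ∀ j (f : Fin N → ℚ) → sumQ (λ k → L j k * f k) ≡ sumQ (λ k → 𝟙 (adj G j k) * (f j - f k))
    L-apply j f = begin
      sumQ (λ k → L j k * f k)
        ≡⟨ sumQ-cong entry ⟩
      sumQ (λ k → 𝟙 ⌊ j Fin.≟ k ⌋ * (κ * f k) - 𝟙 (adj G j k) * f k)
        ≡⟨ sumQ-- (λ k → 𝟙 ⌊ j Fin.≟ k ⌋ * (κ * f k)) (λ k → 𝟙 (adj G j k) * f k) ⟩
      sumQ (λ k → 𝟙 ⌊ j Fin.≟ k ⌋ * (κ * f k)) - sumQ (λ k → 𝟙 (adj G j k) * f k)
        ≡⟨ cong (_- sumQ (λ k → 𝟙 (adj G j k) * f k)) (trans (sumQ-δ j (λ k → κ * f k)) (cong (_* f j) (sym (degree j)))) ⟩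
      sumQ (λ k → 𝟙 (adj G j k)) * f j - sumQ (λ k → 𝟙 (adj G j k) * f k)
        ≡⟨ cong (_- sumQ (λ k → 𝟙 (adj G j k) * f k)) (sym (sumQ-*ʳ (f j) (λ k → 𝟙 (adj G j k)))) ⟩
      sumQ (λ k → 𝟙 (adj G j k) * f j) - sumQ (λ k → 𝟙 (adj G j k) * f k)
        ≡⟨ sym (sumQ-- (λ k → 𝟙 (adj G j k) * f j) (λ k → 𝟙 (adj G j k) * f k)) ⟩
      sumQ (λ k → 𝟙 (adj G j k) * f j - 𝟙 (adj G j k) * f k)
        ≡⟨ sumQ-cong (λ k → solve 3 (λ e x y → e :* x :- e :* y := e :* (x :- y)) refl (𝟙 (adj G j k)) (f j) (f k)) ⟩
      sumQ (λ k → 𝟙 (adj G j k) * (f j - f k)) ∎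
      where
      entry : ∀ k → L j k * f k ≡ 𝟙 ⌊ j Fin.≟ k ⌋ * (κ * f k) - 𝟙 (adj G j k) * f k
      entry k with j Fin.≟ k
      ... | yes refl rewrite adj-irrefl G j = solve 2 (λ κ x → κ :* x := con 1ℚ :* (κ :* x) :- con 0ℚ :* x) refl κ (f j)
      ... | no _ with adj G j k
      ...   | true  = solve 2 (λ κ x → con (- 1ℚ) :* x := con 0ℚ :* (κ :* x) :- con 1ℚ :* x) refl κ (f k)
      ...   | false = solve 2 (λ κ x → con 0ℚ :* x := con 0ℚ :* (κ :* x) :- con 0ℚ :* x) refl κ (f k)

    L-rows : ∀ j → sumQ (λ k → L j k) ≡ 0ℚ
    L-rows j = begin
      sumQ (λ k → L j k)                          ≡⟨ sumQ-cong (λ k → sym (*-identityʳ (L j k))) ⟩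
      sumQ (λ k → L j k * 1ℚ)                     ≡⟨ L-apply j (λ _ → 1ℚ) ⟩
      sumQ (λ k → 𝟙 (adj G j k) * (1ℚ - 1ℚ))      ≡⟨ sumQ-cong (λ k → solve 1 (λ e → e :* (con 1ℚ :- con 1ℚ) := con 0ℚ) refl (𝟙 (adj G j k))) ⟩
      sumQ {N} (λ _ → 0ℚ)                         ≡⟨ sumQ-zero N ⟩
      0ℚ                                          ∎

    L-cols : ∀ j → sumQ (λ k → L k j) ≡ 0ℚ
    L-cols j = trans (sumQ-cong (λ k → L-sym k j)) (L-rows j)

    isDistPred≡ : ∀ i x k → isDistPred G i x k ≡ isPred i (dist x k)
    isDistPred≡ zero    x k = refl
    isDistPred≡ (suc i) x k = isDist≡ i x k

    -- The neighbours of a vertex j at distance i from x lie at distance i − 1,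
    -- i or i + 1 from x; a function of the distance splits accordingly.
    neighbour-split : ∀ i x j k (g : ℕ → ℚ) → isDist G i x j ≡ true →
      𝟙 (adj G j k) * g (dist x k) ≡
        𝟙 (isDistPred G i x k ∧ adj G k j) * g (i ∸ 1) + 𝟙 (isDist G i x k ∧ adj G k j) * g i
          + 𝟙 (isDist G (suc i) x k ∧ adj G k j) * g (suc i)
    neighbour-split i x j k g x-j rewrite adj-sym G k j with adj G j k in a
    ... | false rewrite ∧-zeroʳ (isDistPred G i x k) | ∧-zeroʳ (isDist G i x k) | ∧-zeroʳ (isDist G (suc i) x k) =
      solve 4 (λ l p q r → con 0ℚ :* l := con 0ℚ :* p :+ con 0ℚ :* q :+ con 0ℚ :* r) refl (g (dist x k)) (g (i ∸ 1)) (g i) (g (suc i))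
    ... | true rewrite ∧-identityʳ (isDistPred G i x k) | ∧-identityʳ (isDist G i x k) | ∧-identityʳ (isDist G (suc i) x k)
                     | isDistPred≡ i x k | isDist≡ i x k | isDist≡ (suc i) x k =
      trans (*-identityˡ (g (dist x k))) (sym (threePoint-exact g i (dist x k) k-near j-near))
      where
      k-near : dist x k ≤ suc i
      k-near = subst (λ n → dist x k ≤ suc n) (sym (dist-unique x-j)) (dist-step x a)
      j-near : i ≤ suc (dist x k)
      j-near = subst (_≤ suc (dist x k)) (sym (dist-unique x-j)) (dist-step x (trans (adj-sym G k j) a))

    -- On functions of the distance from x, L acts through the tridiagonal
    -- matrix of the intersection array.
    tridiagonal : (ℕ → ℚ) → ℕ → ℚ
    tridiagonal φ i = ℕtoℚ (c i) * (φ i - φ (i ∸ 1)) + ℕtoℚ (a i) * (φ i - φ i) + ℕtoℚ (b i) * (φ i - φ (suc i))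

    L-radial : ∀ (φ : ℕ → ℚ) x j → sumQ (λ k → L j k * φ (dist x k)) ≡ tridiagonal φ (dist x j)
    L-radial φ x j = begin
      sumQ (λ k → L j k * φ (dist x k))
        ≡⟨ L-apply j (λ k → φ (dist x k)) ⟩
      sumQ (λ k → 𝟙 (adj G j k) * g (dist x k))
        ≡⟨ sumQ-cong (λ k → neighbour-split i x j k g (dist-spec x j)) ⟩
      sumQ (λ k → P k * g (i ∸ 1) + S k * g i + Q k * g (suc i))
        ≡⟨ trans (sumQ-+ (λ k → P k * g (i ∸ 1) + S k * g i) (λ k → Q k * g (suc i)))
                 (cong (_+ sumQ (λ k → Q k * g (suc i))) (sumQ-+ (λ k → P k * g (i ∸ 1)) (λ k → S k * g i))) ⟩
      sumQ (λ k → P k * g (i ∸ 1)) + sumQ (λ k → S k * g i) + sumQ (λ k → Q k * g (suc i))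
        ≡⟨ cong₂ _+_ (cong₂ _+_ (count-at (i ∸ 1) (isDistPred G i x) (proj₁ counts))
                                (count-at i (isDist G i x) (proj₁ (proj₂ counts))))
                     (count-at (suc i) (isDist G (suc i) x) (proj₂ (proj₂ counts))) ⟩
      tridiagonal φ i ∎
      where
      i : ℕ
      i = dist x j
      g : ℕ → ℚ
      g l = φ i - φ l
      P S Q : Fin N → ℚ
      P k = 𝟙 (isDistPred G i x k ∧ adj G k j)
      S k = 𝟙 (isDist G i x k ∧ adj G k j)
      Q k = 𝟙 (isDist G (suc i) x k ∧ adj G k j)
      counts : (countFin (λ k → isDistPred G i x k ∧ adj G k j) ≡ c i)
             × (countFin (λ k → isDist G i x k ∧ adj G k j) ≡ a i)
             × (countFin (λ k → isDist G (suc i) x k ∧ adj G k j) ≡ b i)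
      counts = drg x j i (dist-spec x j)
      count-at : ∀ l (R : Fin N → Bool) {n} → countFin (λ k → R k ∧ adj G k j) ≡ n →
        sumQ (λ k → 𝟙 (R k ∧ adj G k j) * g l) ≡ ℕtoℚ n * g l
      count-at l R refl = trans (sumQ-*ʳ (g l) (λ k → 𝟙 (R k ∧ adj G k j))) (cong (_* g l) (sumQ-count (λ k → R k ∧ adj G k j)))

    Nq : ℚ
    Nq = ℕtoℚ N

    w : ℚ
    w = 1ℚ /ᵗ Nq

    w*N≡1 : w * Nq ≡ 1ℚ
    w*N≡1 = /ᵗ-inverse 1ℚ Nq (ℕtoℚ-nonZero N N-pos)

    S : ℕ → ℚ
    S l = ℕtoℚ (sumUpTo l kv)

    -- r l = N κ_l b_l, the number of (ordered) edges from spheres of radius l to l + 1,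
    -- summed over all centres.
    r : ℕ → ℚ
    r l = ℕtoℚ (N ℕ.* kv l ℕ.* b l)

    r-expand : ∀ l → r l ≡ Nq * ℕtoℚ (kv l) * ℕtoℚ (b l)
    r-expand l = trans (ℕtoℚ-* (N ℕ.* kv l) (b l)) (cong (_* ℕtoℚ (b l)) (ℕtoℚ-* N (kv l)))

    D : ℕ → ℚ
    D l = (Nq - S l) /ᵗ r l

    φ : ℕ → ℚ
    φ zero    = 0ℚ
    φ (suc l) = φ l - D l

    -- The flux identity  D l · N κ_l b_l = N − S l, valid up to the diameter
    -- (at l = d both sides vanish since the ball of radius d is all of Γ).
    flux : ∀ l → l ≤ d → D l * r l ≡ Nq - S l
    flux l l≤d with ℕ.m≤n⇒m<n∨m≡n l≤d
    ... | inj₁ l<d = /ᵗ-inverse (Nq - S l) (r l) (ℕtoℚ-nonZero _ (ℕ.*-mono-≤ (ℕ.*-mono-≤ N-pos (kv-pos l l≤d)) (b-pos l l<d)))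
    ... | inj₂ refl = begin
      D d * r d             ≡⟨ cong (λ p → (p /ᵗ r d) * r d) empty ⟩
      (0ℚ /ᵗ r d) * r d     ≡⟨ trans (cong (_* r d) (0/ᵗ (r d))) (*-zeroˡ (r d)) ⟩
      0ℚ                    ≡⟨ sym empty ⟩
      Nq - S d              ∎
      where
      empty : Nq - S d ≡ 0ℚ
      empty = trans (cong (λ n → Nq - ℕtoℚ n) vertex-count) (+-inverseʳ Nq)

    -- φ solves  L φ = δ₀ − 1/N  on the quotient path 0, 1, …, d.
    tridiagonal-centre : tridiagonal φ 0 ≡ 1ℚ - w
    tridiagonal-centre = trans expand (*-cancelʳ (B₀ * D 0) (1ℚ - w) Nq (ℕtoℚ-nonZero N N-pos) scaled)
      where
      B₀ : ℚ
      B₀ = ℕtoℚ (b 0)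
      expand : tridiagonal φ 0 ≡ B₀ * D 0
      expand = solve 4 (λ c a b x → c :* (con 0ℚ :- con 0ℚ) :+ a :* (con 0ℚ :- con 0ℚ) :+ b :* (con 0ℚ :- (con 0ℚ :- x)) := b :* x)
                 refl (ℕtoℚ (c 0)) (ℕtoℚ (a 0)) B₀ (D 0)
      scaled : B₀ * D 0 * Nq ≡ (1ℚ - w) * Nq
      scaled = begin
        B₀ * D 0 * Nq                        ≡⟨ solve 3 (λ b x n → b :* x :* n := x :* (n :* con 1ℚ :* b)) refl B₀ (D 0) Nq ⟩
        D 0 * (Nq * 1ℚ * B₀)                 ≡⟨ cong (λ k → D 0 * (Nq * ℕtoℚ k * B₀)) (sym kv₀≡1) ⟩
        D 0 * (Nq * ℕtoℚ (kv 0) * B₀)        ≡⟨ cong (D 0 *_) (sym (r-expand 0)) ⟩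
        D 0 * r 0                            ≡⟨ flux 0 z≤n ⟩
        Nq - ℕtoℚ (kv 0)                     ≡⟨ cong (λ k → Nq - ℕtoℚ k) kv₀≡1 ⟩
        Nq - 1ℚ                              ≡⟨ cong (λ v → Nq - v) (sym w*N≡1) ⟩
        Nq - w * Nq                          ≡⟨ solve 2 (λ n v → n :- v :* n := (con 1ℚ :- v) :* n) refl Nq w ⟩
        (1ℚ - w) * Nq                        ∎

    tridiagonal-shell : ∀ i → suc i ≤ d → tridiagonal φ (suc i) ≡ - w
    tridiagonal-shell i i<d = trans expand (*-cancelʳ (B * D (suc i) - C * D i) (- w) (Nq * K) NK≢0 scaled)
      where
      B C K : ℚ
      B = ℕtoℚ (b (suc i))
      C = ℕtoℚ (c (suc i))
      K = ℕtoℚ (kv (suc i))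
      NK≢0 : Nq * K ≢ 0ℚ
      NK≢0 NK≡0 = ℕtoℚ-nonZero _ (ℕ.*-mono-≤ N-pos (kv-pos (suc i) i<d)) (trans (ℕtoℚ-* N (kv (suc i))) NK≡0)
      expand : tridiagonal φ (suc i) ≡ B * D (suc i) - C * D i
      expand = solve 6 (λ c a b p x y → c :* ((p :- x) :- p) :+ a :* ((p :- x) :- (p :- x)) :+ b :* ((p :- x) :- ((p :- x) :- y))
                                         := b :* y :- c :* x)
                 refl C (ℕtoℚ (a (suc i))) B (φ i) (D i) (D (suc i))
      scaled : (B * D (suc i) - C * D i) * (Nq * K) ≡ - w * (Nq * K)
      scaled = begin
        (B * D (suc i) - C * D i) * (Nq * K)
          ≡⟨ solve 6 (λ b y c x n k → (b :* y :- c :* x) :* (n :* k) := y :* (n :* k :* b) :- x :* (n :* (k :* c)))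
                   refl B (D (suc i)) C (D i) Nq K ⟩
        D (suc i) * (Nq * K * B) - D i * (Nq * (K * C))
          ≡⟨ cong₂ (λ u v → D (suc i) * u - D i * (Nq * v)) (sym (r-expand (suc i))) (sym (handshake i)) ⟩
        D (suc i) * r (suc i) - D i * (Nq * (ℕtoℚ (kv i) * ℕtoℚ (b i)))
          ≡⟨ cong (λ u → D (suc i) * r (suc i) - D i * u) (trans (sym (*-assoc Nq _ _)) (sym (r-expand i))) ⟩
        D (suc i) * r (suc i) - D i * r i
          ≡⟨ cong₂ _-_ (flux (suc i) i<d) (flux i (ℕ.<⇒≤ i<d)) ⟩
        (Nq - S (suc i)) - (Nq - S i)
          ≡⟨ cong (λ s → (Nq - s) - (Nq - S i)) (ℕtoℚ-+ (sumUpTo i kv) (kv (suc i))) ⟩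
        (Nq - (S i + K)) - (Nq - S i)
          ≡⟨ solve 3 (λ n s k → (n :- (s :+ k)) :- (n :- s) := :- (con 1ℚ :* k)) refl Nq (S i) K ⟩
        - (1ℚ * K)
          ≡⟨ cong (λ u → - (u * K)) (sym w*N≡1) ⟩
        - (w * Nq * K)
          ≡⟨ solve 3 (λ v n k → :- (v :* n :* k) := :- v :* (n :* k)) refl w Nq K ⟩
        - w * (Nq * K) ∎

    Φ : Mat N
    Φ k x = φ (dist x k)

    Φᵀ : Mat N
    Φᵀ = transpose Φ

    centring-radial : ∀ i {x j} → dist x j ≡ i → tridiagonal φ i ≡ centring w j x
    centring-radial zero {x} {j} x-j = trans tridiagonal-centre (cong (λ e → 𝟙 e - w) (sym (⌊⌋-yes (j Fin.≟ x) (sym x≡j))))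
      where
      x≡j : x ≡ j
      x≡j = ⌊⌋-sound (x Fin.≟ j) (subst (λ i → isDist G i x j ≡ true) x-j (dist-spec x j))
    centring-radial (suc i) {x} {j} x-j =
      trans (tridiagonal-shell i (subst (_≤ d) x-j (dist≤d x j)))
            (sym (trans (cong (λ e → 𝟙 e - w) (⌊⌋-no (j Fin.≟ x) j≢x)) (solve 1 (λ v → con 0ℚ :- v := :- v) refl w)))
      where
      j≢x : j ≢ x
      j≢x refl with trans (sym x-j) (dist-self j)
      ... | ()

    LΦ≡centring : ∀ j x → (L ⊗ Φ) j x ≡ centring w j x
    LΦ≡centring j x = trans (L-radial φ x j) (centring-radial (dist x j) refl)

    ΦᵀL≡centring : ∀ x j → (Φᵀ ⊗ L) x j ≡ centring w x j
    ΦᵀL≡centring x j = begin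
      sumQ (λ k → φ (dist x k) * L k j)
        ≡⟨ sumQ-cong (λ k → trans (*-comm (φ (dist x k)) (L k j)) (cong (_* φ (dist x k)) (L-sym k j))) ⟩
      (L ⊗ Φ) j x                         ≡⟨ LΦ≡centring j x ⟩
      centring w j x                      ≡⟨ centring-sym w j x ⟩
      centring w x j                      ∎

    T : ℚ
    T = sumUpToQ d (λ l → ℕtoℚ (kv l) * φ l)

    module _ (X : Mat N) (X-pinv : IsMoorePenrose L X) where
      open CentredInverse L Φ Φᵀ X w L-rows L-cols LΦ≡centring ΦᵀL≡centring X-pinv

      pinv-radial : ∀ i j → X i j ≡ φ (dist i j) - w * T
      pinv-radial i j = trans (pinv-via-left i j) (cong (λ s → φ (dist i j) - w * s) (radial-sum i φ))

      pinv-radial′ : ∀ i j → X i j ≡ φ (dist j i) - w * T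
      pinv-radial′ i j = trans (pinv-via-right i j) (cong (λ s → φ (dist j i) - w * s) (radial-sum j φ))

      resistance-radial : ∀ α γ → resistance X α γ ≡ ℕtoℚ 2 * (φ 0 - φ (dist α γ))
      resistance-radial α γ = begin
        X α α + X γ γ - X α γ - X γ α
          ≡⟨ cong₂ _-_ (cong₂ _-_ (cong₂ _+_ (diagonal α) (diagonal γ)) (pinv-radial α γ)) (pinv-radial′ γ α) ⟩
        (φ 0 - w * T) + (φ 0 - w * T) - (φ (dist α γ) - w * T) - (φ (dist α γ) - w * T)
          ≡⟨ solve 3 (λ z p t → (z :- t) :+ (z :- t) :- (p :- t) :- (p :- t) := (con 1ℚ :+ con 1ℚ) :* (z :- p))
                   refl (φ 0) (φ (dist α γ)) (w * T) ⟩
        (1ℚ + 1ℚ) * (φ 0 - φ (dist α γ))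
          ≡⟨ cong (_* (φ 0 - φ (dist α γ))) (sym (ℕtoℚ-+ 1 1)) ⟩
        ℕtoℚ 2 * (φ 0 - φ (dist α γ)) ∎
        where
        diagonal : ∀ x → X x x ≡ φ 0 - w * T
        diagonal x = trans (pinv-radial x x) (cong (λ l → φ l - w * T) (dist-self x))

      resistance-gap : ∀ m {α β γ} → isDist G m α β ≡ true → isDist G (suc m) α γ ≡ true →
        resistance X α γ - resistance X α β ≡ (ℕtoℚ 2 * (Nq - S m)) /ᵗ r m
      resistance-gap m {α} {β} {γ} α-β α-γ = begin
        resistance X α γ - resistance X α β
          ≡⟨ cong₂ _-_ (resistance-radial α γ) (resistance-radial α β) ⟩
        ℕtoℚ 2 * (φ 0 - φ (dist α γ)) - ℕtoℚ 2 * (φ 0 - φ (dist α β))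
          ≡⟨ cong₂ (λ p q → ℕtoℚ 2 * (φ 0 - φ p) - ℕtoℚ 2 * (φ 0 - φ q))
                   (sym (dist-unique {suc m} {α} {γ} α-γ)) (sym (dist-unique {m} {α} {β} α-β)) ⟩
        ℕtoℚ 2 * (φ 0 - (φ m - D m)) - ℕtoℚ 2 * (φ 0 - φ m)
          ≡⟨ solve 4 (λ t z p x → t :* (z :- (p :- x)) :- t :* (z :- p) := t :* x) refl (ℕtoℚ 2) (φ 0) (φ m) (D m) ⟩
        ℕtoℚ 2 * D m
          ≡⟨ *-/ᵗ-assoc (ℕtoℚ 2) (Nq - S m) (r m) ⟩
        (ℕtoℚ 2 * (Nq - S m)) /ᵗ r m ∎

    -- Below the diameter the ball of radius m is a proper subset, so the gap is positive.
    gap-positive : ∀ m → m < d → 0ℚ <ℚ (ℕtoℚ 2 * (Nq - S m)) /ᵗ r m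
    gap-positive m m<d = subst (λ p → 0ℚ <ℚ p /ᵗ r m) numerator
      (/ᵗ-positive (2 ℕ.* (N ∸ sumUpTo m kv)) (N ℕ.* kv m ℕ.* b m)
        (ℕ.*-mono-≤ {1} {2} (s≤s z≤n) (ℕ.m<n⇒0<n∸m ball<N))
        (ℕ.*-mono-≤ (ℕ.*-mono-≤ N-pos (kv-pos m (ℕ.<⇒≤ m<d))) (b-pos m m<d)))
      where
      ball<N : sumUpTo m kv < N
      ball<N = ℕ.<-≤-trans (ℕ.m<m+n (sumUpTo m kv) (kv-pos (suc m) m<d))
                           (subst (sumUpTo (suc m) kv ≤_) vertex-count (sumUpTo-mono kv (ℕ.≤⇒≤′ m<d)))
      numerator : ℕtoℚ (2 ℕ.* (N ∸ sumUpTo m kv)) ≡ ℕtoℚ 2 * (Nq - S m)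
      numerator = trans (ℕtoℚ-* 2 (N ∸ sumUpTo m kv)) (cong (ℕtoℚ 2 *_) (ℕtoℚ-∸ N (sumUpTo m kv) (ℕ.<⇒≤ ball<N)))

-- The theorem in the notation of the statement: the gap formula and its
-- positivity.

open import Defs
open import Data.Nat using (ℕ; suc; _≤_; _<_; _*_)
open import Data.Fin using (Fin)
open import Data.Bool using (true)
open import Data.Product using (_×_; _,_)
open import Relation.Binary.PropositionalEquality using (_≡_)
open import Data.Rational using (ℚ; _-_; 0ℚ) renaming (_*_ to _*ℚ_; _<_ to _<ℚ_)

mainTheorem1 : (N : ℕ) (G : SimpleGraph N) (d : ℕ) (b a c kv : ℕ → ℕ)
    → 2 ≤ d
    → Connected G
    → HasDiameter G d
    → IsDistanceRegular G b a c
    → HasValencies G kv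
    → (Lp : Mat N) → IsMoorePenrose (laplacian G (ℕtoℚ (b 0))) Lp
    → (m : ℕ) → 1 ≤ m → m < d
    → (α β γ : Fin N) → isDist G m α β ≡ true → isDist G (suc m) α γ ≡ true
    → (resistance Lp α γ - resistance Lp α β
         ≡ (ℕtoℚ 2 *ℚ (ℕtoℚ N - ℕtoℚ (sumUpTo m kv))) /ᵗ ℕtoℚ (N * kv m * b m))
      × (0ℚ <ℚ (ℕtoℚ 2 *ℚ (ℕtoℚ N - ℕtoℚ (sumUpTo m kv))) /ᵗ ℕtoℚ (N * kv m * b m))
mainTheorem1 N G d b a c kv _ conn diam drg val Lp Lp-pinv m _ m<d α β γ α-β α-γ =
  resistance-gap Lp Lp-pinv m α-β α-γ , gap-positive m m<d
  where open ResistanceDistance.DistanceRegular G d b a c kv conn diam drg val
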